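{- Let $t$ be a positive integer, let $H$ be a nonempty $(2t)$-uniform hypergraph with vertex set $X$, and let $Y\subseteq X$. Suppose there are nonnegative integers $e_0,\ldots,e_t$ such that (i) $|\{E\in\mathcal{E}(H):|E\cap Y|=t+i\}|=|\{E\in\mathcal{E}(H):|E\cap Y|=t-i\}|=e_i$ for each $i\in\{0,\ldots,t\}$; and (ii) $e_i\geqslant e_{i+1}+s$ for each $i\in\{0,\ldots,s-1\}$, where $s$ is the largest element of $\{0,\ldots,t\}$ such that $e_s>0$. Then for any $p\in\{0,\ldots,\lfloor\frac13|\mathcal{E}(H)|\rfloor\}$ there is a subset $\mathcal{E}^*$ of $\mathcal{E}(H)$ and a partition of $\mathcal{E}^*$ into $p$ unordered triples such that - $\sum_{i=1}^3|E_i\cap Y|=3t$ for each triple $\{E_1,E_2,E_3\}$; and - $|\mathcal{E}^*_i|=|\mathcal{E}^*_{ -i}|$ for each $i\in\{1,\ldots,t\}$, where $\mathcal{E}^*_i=\{E\in\mathcal{E}^*:|E\cap Y|=t+i\}$ for $i\in\{ -t,\ldots,t\}$.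
   Context: A hypergraph $H$ consists of a finite vertex set $V(H)$ and a set $\mathcal{E}(H)$ of edges, each a subset of $V(H)$ (no multiple edges). It is $(2t)$-uniform if every edge has exactly $2t$ elements. -}

module Defs where

open import Data.Nat using (ℕ; _≟_; _+_)
open import Data.Fin.Subset using (Subset; _∩_; ∣_∣)
open import Data.List using (List; []; _∷_; filter; length; concatMap)
open import Data.Product using (_×_; _,_)
open import Relation.Nullary.Decidable using (¬?)

-- A hypergraph on the vertex set Fin n: a list of edges (subsets of Fin n);
-- "no multiple edges" is imposed separately via Unique.

meet : ∀ {n} → Subset n → Subset n → ℕ
meet Y E = ∣ E ∩ Y ∣

edgesAt : ∀ {n} → Subset n → List (Subset n) → ℕ → List (Subset n)
edgesAt Y es k = filter (λ E → meet Y E ≟ k) es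

countAt : ∀ {n} → Subset n → List (Subset n) → ℕ → ℕ
countAt Y es k = length (edgesAt Y es k)

flatten : ∀ {n} → List (Subset n × Subset n × Subset n) → List (Subset n)
flatten = concatMap (λ { (a , b , c) → a ∷ b ∷ c ∷ [] })

-- Write c k for the number of edges E with |E ∩ Y| = k. It suffices to find p triples of levels, each summing to 3t, that use level k at most
-- c k times and the levels t + i and t − i equally often: distinct edges of those levels can then
-- be picked one by one. The triples are found greedily by recursion on (p, s). If s = 0 all edges
-- are at level t and (t, t, t) works; if p ≤ c (t + 1), take p copies of (t + 1, t − 1, t).
-- Otherwise the top level t + s holds 0, 1, 2 or at least 3 edges, and we respectively lower s;
-- use (t + s, t − s, t); use (t + s, t − s, t), (t + s, t − s + 1, t − 1), (t − s, t + s − 1, t + 1)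
-- (two copies of (t + 1, t − 1, t) when s = 1); or use a block of 2s + 1 triples taking exactly
-- three edges from each of the levels t − s, …, t + s. Each step leaves a symmetric profile
-- satisfying (ii) for the new s, and the block fits because the gaps give
-- c (t + 1) ≥ 3 + s (s − 1) ≥ 2s + 1.
module Submission where

open import Defs
open import Data.Nat using (ℕ; zero; suc; _+_; _*_; _∸_; _≤_; _<_; _/_; z≤n; s≤s; _≟_; _≤?_)
open import Data.Nat.DivMod using (m/n*n≤m)
open import Data.Nat.Properties
open import Data.Nat.Tactic.RingSolver using (solve-∀)
open import Data.Fin.Subset using (Subset; ∣_∣)
open import Data.Fin.Subset.Properties using (∣p∩q∣≤∣p∣)
open import Data.Product using (Σ; _×_; _,_; proj₁; proj₂)
open import Data.List using (List; []; _∷_; _++_; length; map; replicate; filter)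
open import Data.List.Properties using (length-++; length-replicate; length-map; ∷-injectiveˡ; ∷-injectiveʳ; filter-accept; filter-reject)
open import Relation.Binary.PropositionalEquality
open import Relation.Nullary using (yes; no)
open import Data.Empty using (⊥-elim)
open import Function using (_∘_)
open import Data.List.Relation.Unary.All as All using (All; []; _∷_)
open import Data.List.Relation.Unary.All.Properties using (++⁺; replicate⁺; map⁺; map⁻; All¬⇒¬Any; ¬Any⇒All¬)
open import Data.List.Relation.Unary.Any using (here; there)
open import Data.List.Relation.Unary.AllPairs using ([]; _∷_)
open import Data.List.Relation.Unary.Unique.Propositional using (Unique)
open import Data.List.Membership.Propositional using (_∈_; _∉_)

δ : ℕ → ℕ → ℕ
δ x k with x ≟ k
... | yes _ = 1
... | no _ = 0

δ≡1 : ∀ {x k} → x ≡ k → δ x k ≡ 1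
δ≡1 {x} {k} x≡k with x ≟ k
... | yes _ = refl
... | no x≢k = ⊥-elim (x≢k x≡k)

δ≡0 : ∀ {x k} → x ≢ k → δ x k ≡ 0
δ≡0 {x} {k} x≢k with x ≟ k
... | yes x≡k = ⊥-elim (x≢k x≡k)
... | no _ = refl

δ-refl : ∀ k → δ k k ≡ 1
δ-refl k = δ≡1 refl

δ≤1 : ∀ x k → δ x k ≤ 1
δ≤1 x k with x ≟ k
... | yes _ = ≤-refl
... | no _ = z≤n

δ+δ≤1 : ∀ x y k → x ≢ y → δ x k + δ y k ≤ 1
δ+δ≤1 x y k x≢y with x ≟ k
... | yes refl rewrite δ≡0 (≢-sym x≢y) = ≤-refl
... | no _ = δ≤1 y k

δ-resp-⇔ : ∀ {x y k l} → (x ≡ k → y ≡ l) → (y ≡ l → x ≡ k) → δ x k ≡ δ y l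
δ-resp-⇔ {x} {k = k} to from with x ≟ k
... | yes x≡k = sym (δ≡1 (to x≡k))
... | no x≢k = sym (δ≡0 (x≢k ∘ from))

δ-cancelˡ-+ : ∀ t a i → δ (t + a) (t + i) ≡ δ a i
δ-cancelˡ-+ t a i = δ-resp-⇔ (+-cancelˡ-≡ t a i) (cong (t +_))

δ-cancelˡ-∸ : ∀ {t a i} → a ≤ t → i ≤ t → δ (t ∸ a) (t ∸ i) ≡ δ a i
δ-cancelˡ-∸ {t} a≤t i≤t = δ-resp-⇔ (∸-cancelˡ-≡ a≤t i≤t) (cong (t ∸_))

δ-centre-+ : ∀ t i → δ t (t + i) ≡ δ 0 i
δ-centre-+ t i = trans (cong (λ x → δ x (t + i)) (sym (+-identityʳ t))) (δ-cancelˡ-+ t 0 i)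

δ-centre-∸ : ∀ {t i} → i ≤ t → δ t (t ∸ i) ≡ δ 0 i
δ-centre-∸ {t} i≤t = δ-cancelˡ-∸ {t} z≤n i≤t

δ-below-above : ∀ {t a} i → 1 ≤ a → a ≤ t → δ (t ∸ a) (t + i) ≡ 0
δ-below-above {t} {a} i 1≤a a≤t = δ≡0 (<⇒≢ (≤-trans (∸-monoʳ-< {t} {a} {0} 1≤a a≤t) (m≤m+n t i)))

δ-above-below : ∀ {t a} i → 1 ≤ a → δ (t + a) (t ∸ i) ≡ 0
δ-above-below {t} {a} i 1≤a = δ≡0 (≢-sym (<⇒≢ (<-≤-trans (s≤s (m∸n≤m t i)) t+1≤t+a)))
  where
  t+1≤t+a : suc t ≤ t + a
  t+1≤t+a = subst (_≤ t + a) (+-comm t 1) (+-monoʳ-≤ t 1≤a)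

count : ℕ → List ℕ → ℕ
count k [] = 0
count k (x ∷ xs) = δ x k + count k xs

count-++ : ∀ k xs ys → count k (xs ++ ys) ≡ count k xs + count k ys
count-++ k [] ys = refl
count-++ k (x ∷ xs) ys rewrite count-++ k xs ys = sym (+-assoc (δ x k) _ _)

∑< : ℕ → (ℕ → ℕ) → ℕ
∑< zero f = 0
∑< (suc N) f = ∑< N f + f N

∑<-cong : ∀ N {f g} → (∀ k → f k ≡ g k) → ∑< N f ≡ ∑< N g
∑<-cong zero f≡g = refl
∑<-cong (suc N) f≡g = cong₂ _+_ (∑<-cong N f≡g) (f≡g N)

∑<-distrib-+ : ∀ N f g → ∑< N (λ k → f k + g k) ≡ ∑< N f + ∑< N g
∑<-distrib-+ zero f g = refl
∑<-distrib-+ (suc N) f g rewrite ∑<-distrib-+ N f g = rearrange (∑< N f) (∑< N g) (f N) (g N)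
  where
  rearrange : ∀ a b c d → a + b + (c + d) ≡ a + c + (b + d)
  rearrange = solve-∀

∑<-zero : ∀ N f → (∀ k → k < N → f k ≡ 0) → ∑< N f ≡ 0
∑<-zero zero f f≡0 = refl
∑<-zero (suc N) f f≡0 rewrite ∑<-zero N f (λ k k<N → f≡0 k (m<n⇒m<1+n k<N)) | f≡0 N ≤-refl = refl

∑<-≤-single : ∀ N t f → (∀ k → k < N → k ≢ t → f k ≡ 0) → ∑< N f ≤ f t
∑<-≤-single zero t f f≡0 = z≤n
∑<-≤-single (suc N) t f f≡0 with N ≟ t
... | yes refl rewrite ∑<-zero N f (λ k k<N → f≡0 k (m<n⇒m<1+n k<N) (<⇒≢ k<N)) = ≤-refl
... | no N≢t rewrite f≡0 N ≤-refl N≢t | +-identityʳ (∑< N f) =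
  ∑<-≤-single N t f (λ k k<N → f≡0 k (m<n⇒m<1+n k<N))

∑<-δ≤1 : ∀ N x → ∑< N (δ x) ≤ 1
∑<-δ≤1 zero x = z≤n
∑<-δ≤1 (suc N) x with x ≟ N
... | yes refl rewrite ∑<-zero N (δ N) (λ k k<N → δ≡0 (≢-sym (<⇒≢ k<N))) = ≤-refl
... | no _ rewrite +-identityʳ (∑< N (δ x)) = ∑<-δ≤1 N x

∑<-δ≡1 : ∀ N x → x < N → ∑< N (δ x) ≡ 1
∑<-δ≡1 (suc N) x x<1+N with x ≟ N
... | yes refl rewrite ∑<-zero N (δ N) (λ k k<N → δ≡0 (≢-sym (<⇒≢ k<N))) = refl
... | no x≢N rewrite +-identityʳ (∑< N (δ x)) = ∑<-δ≡1 N x (≤∧≢⇒< (≤-pred x<1+N) x≢N)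

∑<-count≤length : ∀ N xs → ∑< N (λ k → count k xs) ≤ length xs
∑<-count≤length N [] = ≤-reflexive (∑<-zero N (λ _ → 0) (λ _ _ → refl))
∑<-count≤length N (x ∷ xs) rewrite ∑<-distrib-+ N (δ x) (λ k → count k xs) =
  +-mono-≤ (∑<-δ≤1 N x) (∑<-count≤length N xs)

∑<-count≡length : ∀ N xs → All (_< N) xs → ∑< N (λ k → count k xs) ≡ length xs
∑<-count≡length N [] [] = ∑<-zero N (λ _ → 0) (λ _ _ → refl)
∑<-count≡length N (x ∷ xs) (x<N ∷ xs<N) rewrite ∑<-distrib-+ N (δ x) (λ k → count k xs)
  | ∑<-δ≡1 N x x<N | ∑<-count≡length N xs xs<N = refl

-- Triples of levels and the block construction

m+m+m≡3*m : ∀ m → m + m + m ≡ 3 * m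
m+m+m≡3*m = solve-∀

Triple : Set
Triple = ℕ × ℕ × ℕ

total : Triple → ℕ
total (a , b , c) = a + b + c

levels : List Triple → List ℕ
levels [] = []
levels ((a , b , c) ∷ ts) = a ∷ b ∷ c ∷ levels ts

levels-++ : ∀ ts us → levels (ts ++ us) ≡ levels ts ++ levels us
levels-++ [] us = refl
levels-++ ((a , b , c) ∷ ts) us = cong (λ l → a ∷ b ∷ c ∷ l) (levels-++ ts us)

length-levels : ∀ ts → length (levels ts) ≡ 3 * length ts
length-levels [] = refl
length-levels ((a , b , c) ∷ ts) rewrite length-levels ts = sym (*-suc 3 (length ts))

occ : List Triple → ℕ → ℕ
occ ts k = count k (levels ts)

occ-++ : ∀ ts us k → occ (ts ++ us) k ≡ occ ts k + occ us k
occ-++ ts us k rewrite levels-++ ts us = count-++ k (levels ts) (levels us)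

occ-replicate : ∀ q T k → occ (replicate q T) k ≡ q * occ (T ∷ []) k
occ-replicate zero T k = refl
occ-replicate (suc q) T k rewrite occ-++ (T ∷ []) (replicate q T) k | occ-replicate q T k = refl

interval : ℕ → ℕ → List ℕ
interval x zero = []
interval x (suc n) = x ∷ interval (suc x) n

inInterval : ℕ → ℕ → ℕ → ℕ
inInterval k x n = count k (interval x n)

inInterval-split : ∀ k x m n → inInterval k x m + inInterval k (x + m) n ≡ inInterval k x (m + n)
inInterval-split k x zero n rewrite +-identityʳ x = refl
inInterval-split k x (suc m) n rewrite +-suc x m =
  trans (+-assoc (δ x k) _ _) (cong (δ x k +_) (inInterval-split k (suc x) m n))

inInterval-snoc : ∀ k x n → inInterval k x n + δ (x + n) k ≡ inInterval k x (suc n)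
inInterval-snoc k x n = begin
  inInterval k x n + δ (x + n) k             ≡⟨ cong (inInterval k x n +_) (sym (+-identityʳ _)) ⟩
  inInterval k x n + inInterval k (x + n) 1  ≡⟨ inInterval-split k x n 1 ⟩
  inInterval k x (n + 1)                     ≡⟨ cong (inInterval k x) (+-comm n 1) ⟩
  inInterval k x (suc n)                     ∎
  where open ≡-Reasoning

inInterval-below : ∀ k x n → k < x → inInterval k x n ≡ 0
inInterval-below k x zero _ = refl
inInterval-below k x (suc n) k<x rewrite δ≡0 (≢-sym (<⇒≢ k<x)) = inInterval-below k (suc x) n (m<n⇒m<1+n k<x)

inInterval-above : ∀ k x n → x + n ≤ k → inInterval k x n ≡ 0
inInterval-above k x zero _ = refl
inInterval-above k x (suc n) x+1+n≤k rewrite +-suc x n | δ≡0 (<⇒≢ (<-≤-trans (s≤s (m≤m+n x n)) x+1+n≤k)) =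
  inInterval-above k (suc x) n x+1+n≤k

inInterval-inside : ∀ k x n → x ≤ k → k < x + n → inInterval k x n ≡ 1
inInterval-inside k x zero x≤k k<x+0 = ⊥-elim (<-irrefl refl (<-≤-trans k<x+0 (≤-trans (≤-reflexive (+-identityʳ x)) x≤k)))
inInterval-inside k x (suc n) x≤k k<x+1+n with x ≟ k
... | yes refl = cong suc (inInterval-below k (suc k) n ≤-refl)
... | no x≢k = inInterval-inside k (suc x) n (≤∧≢⇒< x≤k x≢k) (≤-trans k<x+1+n (≤-reflexive (+-suc x n)))

strides : ℕ → ℕ → List ℕ
strides c zero = c ∷ []
strides c (suc m) = c + (suc m + suc m) ∷ strides c m

strides-interleave : ∀ k b r → count k (strides b (suc r)) + count k (strides (suc b) r) ≡ inInterval k b (3 + (r + r))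
strides-interleave k b zero = trans (cong (λ y → δ y k + (δ b k + 0) + (δ (suc b) k + 0)) (+-comm b 2))
                                    (rearrange (δ (suc (suc b)) k) (δ b k) (δ (suc b) k))
  where
  rearrange : ∀ a u v → a + (u + 0) + (v + 0) ≡ u + (v + (a + 0))
  rearrange = solve-∀
strides-interleave k b (suc r) = begin
    δ top k + count k (strides b (suc r)) + (δ below k + count k (strides (suc b) r))
  ≡⟨ rearrange (δ top k) (count k (strides b (suc r))) (δ below k) (count k (strides (suc b) r)) ⟩
    count k (strides b (suc r)) + count k (strides (suc b) r) + δ below k + δ top k
  ≡⟨ cong (λ c → c + δ below k + δ top k) (strides-interleave k b r) ⟩
    inInterval k b n + δ below k + δ top k
  ≡⟨ cong₂ (λ y z → inInterval k b n + δ y k + δ z k) (below≡ b r) (top≡ b r) ⟩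
    inInterval k b n + δ (b + n) k + δ (b + suc n) k
  ≡⟨ cong (_+ δ (b + suc n) k) (inInterval-snoc k b n) ⟩
    inInterval k b (suc n) + δ (b + suc n) k
  ≡⟨ inInterval-snoc k b (suc n) ⟩
    inInterval k b (suc (suc n))
  ≡⟨ cong (λ m → inInterval k b (3 + m)) (n≡ r) ⟩
    inInterval k b (3 + (suc r + suc r))
  ∎
  where
  open ≡-Reasoning
  n = 3 + (r + r)
  top = b + (suc (suc r) + suc (suc r))
  below = suc b + (suc r + suc r)
  rearrange : ∀ a u d v → a + u + (d + v) ≡ u + v + d + a
  rearrange = solve-∀
  below≡ : ∀ b r → suc b + (suc r + suc r) ≡ b + (3 + (r + r))
  below≡ = solve-∀
  top≡ : ∀ b r → b + (suc (suc r) + suc (suc r)) ≡ b + suc (3 + (r + r))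
  top≡ = solve-∀
  n≡ : ∀ r → 2 + (r + r) ≡ suc r + suc r
  n≡ = solve-∀

fan : ℕ → ℕ → ℕ → ℕ → List Triple
fan x z c zero = (x , c , z) ∷ []
fan x z c (suc m) = (x , c + (suc m + suc m) , z) ∷ fan (suc x) (suc z) c m

length-fan : ∀ x z c m → length (fan x z c m) ≡ suc m
length-fan x z c zero = refl
length-fan x z c (suc m) = cong suc (length-fan (suc x) (suc z) c m)

fan-total : ∀ x z c m → All (λ T → total T ≡ x + (c + (m + m)) + z) (fan x z c m)
fan-total x z c zero = cong (λ y → x + y + z) (sym (+-identityʳ c)) ∷ []
fan-total x z c (suc m) = refl ∷ All.map (λ eq → trans eq (shift x z c m)) (fan-total (suc x) (suc z) c m)
  where
  shift : ∀ x z c m → suc x + (c + (m + m)) + suc z ≡ x + (c + (suc m + suc m)) + z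
  shift = solve-∀

occ-fan : ∀ k x z c m → occ (fan x z c m) k ≡ inInterval k x (suc m) + count k (strides c m) + inInterval k z (suc m)
occ-fan k x z c zero = rearrange (δ x k) (δ c k) (δ z k)
  where
  rearrange : ∀ a b d → a + (b + (d + 0)) ≡ a + 0 + (b + 0) + (d + 0)
  rearrange = solve-∀
occ-fan k x z c (suc m) rewrite occ-fan k (suc x) (suc z) c m =
  rearrange (δ x k) (δ (c + (suc m + suc m)) k) (δ z k) (inInterval k (suc x) (suc m)) (count k (strides c m)) (inInterval k (suc z) (suc m))
  where
  rearrange : ∀ a b d u v w → a + (b + (d + (u + v + w))) ≡ a + u + (b + v) + (d + w)
  rearrange = solve-∀

-- With s = r + 1, the triples (b + s + j, b + 2(s − j), b + j) for j ≤ s and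
-- (b + j, b + 1 + 2(r − j), b + s + 1 + j) for j ≤ r. Each has total 3(b + s), and each of the
-- three columns runs once through [b, b + 2s], the middle one in two interleaved strides.
block : ℕ → ℕ → List Triple
block b r = fan (b + suc r) b b (suc r) ++ fan b (b + suc (suc r)) (suc b) r

length-block : ∀ b r → length (block b r) ≡ 3 + (r + r)
length-block b r = begin
  length (block b r)  ≡⟨ length-++ (fan (b + suc r) b b (suc r)) ⟩
  length (fan (b + suc r) b b (suc r)) + length (fan b (b + suc (suc r)) (suc b) r)
    ≡⟨ cong₂ _+_ (length-fan (b + suc r) b b (suc r)) (length-fan b (b + suc (suc r)) (suc b) r) ⟩
  suc (suc r) + suc r ≡⟨ rearrange r ⟩
  3 + (r + r)         ∎
  where
  open ≡-Reasoning
  rearrange : ∀ r → suc (suc r) + suc r ≡ 3 + (r + r)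
  rearrange = solve-∀

block-total : ∀ b r → All (λ T → total T ≡ 3 * (b + suc r)) (block b r)
block-total b r = ++⁺ (All.map (λ eq → trans eq (first b r)) (fan-total (b + suc r) b b (suc r)))
                      (All.map (λ eq → trans eq (second b r)) (fan-total b (b + suc (suc r)) (suc b) r))
  where
  first : ∀ b r → b + suc r + (b + (suc r + suc r)) + b ≡ 3 * (b + suc r)
  first = solve-∀
  second : ∀ b r → b + (suc b + (r + r)) + (b + suc (suc r)) ≡ 3 * (b + suc r)
  second = solve-∀

occ-block : ∀ k b r → occ (block b r) k ≡ 3 * inInterval k b (3 + (r + r))
occ-block k b r rewrite occ-++ (fan (b + suc r) b b (suc r)) (fan b (b + suc (suc r)) (suc b) r) k
  | occ-fan k (b + suc r) b b (suc r) | occ-fan k b (b + suc (suc r)) (suc b) r = begin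
    I (b + suc r) (suc (suc r)) + count k (strides b (suc r)) + I b (suc (suc r))
      + (I b (suc r) + count k (strides (suc b) r) + I (b + suc (suc r)) (suc r))
  ≡⟨ rearrange (I (b + suc r) (suc (suc r))) (count k (strides b (suc r))) (I b (suc (suc r)))
           (I b (suc r)) (count k (strides (suc b) r)) (I (b + suc (suc r)) (suc r)) ⟩
    (I b (suc r) + I (b + suc r) (suc (suc r)))
      + (count k (strides b (suc r)) + count k (strides (suc b) r))
      + (I b (suc (suc r)) + I (b + suc (suc r)) (suc r))
  ≡⟨ cong₃ (λ u v w → u + v + w) (inInterval-split k b (suc r) (suc (suc r)))
                                 (strides-interleave k b r)
                                 (inInterval-split k b (suc (suc r)) (suc r)) ⟩
    I b (suc r + suc (suc r)) + I b n + I b (suc (suc r) + suc r)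
  ≡⟨ cong₂ (λ u v → I b u + I b n + I b v) (n≡₁ r) (n≡₂ r) ⟩
    I b n + I b n + I b n
  ≡⟨ m+m+m≡3*m (I b n) ⟩
    3 * I b n
  ∎
  where
  open ≡-Reasoning
  I = inInterval k
  n = 3 + (r + r)
  cong₃ : ∀ {a b c x y z : ℕ} (f : ℕ → ℕ → ℕ → ℕ) → a ≡ x → b ≡ y → c ≡ z → f a b c ≡ f x y z
  cong₃ f refl refl refl = refl
  rearrange : ∀ a u d v w x → a + u + d + (v + w + x) ≡ (v + a) + (u + w) + (d + x)
  rearrange = solve-∀
  n≡₁ : ∀ r → suc r + suc (suc r) ≡ 3 + (r + r)
  n≡₁ = solve-∀
  n≡₂ : ∀ r → suc (suc r) + suc r ≡ 3 + (r + r)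
  n≡₂ = solve-∀

-- Choosing distinct elements of prescribed levels

module _ {A : Set} (f : A → ℕ) where

  record Removal (k : ℕ) (pool : List A) : Set where
    field
      elem : A
      rest : List A
      elem-level : f elem ≡ k
      elem∈pool : elem ∈ pool
      rest⊆pool : All (_∈ pool) rest
      elem∉rest : elem ∉ rest
      rest-unique : Unique rest
      count-rest : ∀ j → count j (map f pool) ≡ δ k j + count j (map f rest)

  remove : ∀ k pool → Unique pool → 1 ≤ count k (map f pool) → Removal k pool
  remove k (x ∷ xs) (x∉xs ∷ xs-unique) k-occurs with f x ≟ k
  ... | yes fx≡k = record
    { elem = x ; rest = xs ; elem-level = fx≡k ; elem∈pool = here refl
    ; rest⊆pool = All.tabulate there ; elem∉rest = All¬⇒¬Any x∉xs ; rest-unique = xs-unique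
    ; count-rest = λ j → cong (λ y → δ y j + count j (map f xs)) fx≡k }
  ... | no _ = record
    { elem = elem ; rest = x ∷ rest ; elem-level = elem-level ; elem∈pool = there elem∈pool
    ; rest⊆pool = here refl ∷ All.map there rest⊆pool
    ; elem∉rest = λ { (here elem≡x) → All¬⇒¬Any x∉xs (subst (_∈ xs) elem≡x elem∈pool) ; (there m) → elem∉rest m }
    ; rest-unique = All.map (λ y∈xs → All.lookup x∉xs y∈xs) rest⊆pool ∷ rest-unique
    ; count-rest = λ j → trans (cong (δ (f x) j +_) (count-rest j)) (left-comm (δ (f x) j) (δ k j) _) }
    where
    open Removal (remove k xs xs-unique k-occurs)
    left-comm : ∀ a b c → a + (b + c) ≡ b + (a + c)
    left-comm = solve-∀

  realize : ∀ ks pool → Unique pool → (∀ k → count k ks ≤ count k (map f pool)) →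
            Σ (List A) λ L → map f L ≡ ks × Unique L × All (_∈ pool) L
  realize [] pool _ _ = [] , refl , [] , []
  realize (k ∷ ks) pool pool-unique ks≤pool =
    elem ∷ L , cong₂ _∷_ elem-level fL≡ks
    , ¬Any⇒All¬ L (λ elem∈L → elem∉rest (All.lookup L⊆rest elem∈L)) ∷ L-unique
    , elem∈pool ∷ All.map (All.lookup rest⊆pool) L⊆rest
    where
    k∈pool : 1 ≤ count k (map f pool)
    k∈pool = ≤-trans (subst (_≤ δ k k + count k ks) (δ-refl k) (m≤m+n (δ k k) (count k ks))) (ks≤pool k)
    open Removal (remove k pool pool-unique k∈pool)
    ks≤rest : ∀ j → count j ks ≤ count j (map f rest)
    ks≤rest j = +-cancelˡ-≤ (δ k j) _ _ (≤-trans (ks≤pool j) (≤-reflexive (count-rest j)))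
    realized = realize ks rest rest-unique ks≤rest
    L = proj₁ realized
    fL≡ks = proj₁ (proj₂ realized)
    L-unique = proj₁ (proj₂ (proj₂ realized))
    L⊆rest = proj₂ (proj₂ (proj₂ realized))

  length-filter≡count : ∀ k xs → length (filter (λ x → f x ≟ k) xs) ≡ count k (map f xs)
  length-filter≡count k [] = refl
  length-filter≡count k (x ∷ xs) with f x ≟ k
  ... | yes fx≡k = trans (cong length (filter-accept (λ y → f y ≟ k) fx≡k)) (cong suc (length-filter≡count k xs))
  ... | no fx≢k = trans (cong length (filter-reject (λ y → f y ≟ k) fx≢k)) (length-filter≡count k xs)

-- Level plans

m≤1+m∸n : ∀ m {n} → n ≤ 1 → m ≤ suc (m ∸ n)
m≤1+m∸n m {n} n≤1 = ≤-trans (m≤n+m∸n m n) (+-monoˡ-≤ (m ∸ n) n≤1)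

fuel-step : ∀ {s s′ p L f} → s′ ≤ s → 1 ≤ L → L ≤ p → s + p ≤ suc f → s′ + (p ∸ L) ≤ f
fuel-step {s} {s′} {suc p} {suc L} {f} s′≤s _ _ fuel = begin
  s′ + (p ∸ L)  ≤⟨ +-mono-≤ s′≤s (m∸n≤m p L) ⟩
  s + p         ≤⟨ ≤-pred (subst (_≤ suc f) (+-suc s p) fuel) ⟩
  f             ∎
  where open ≤-Reasoning

twin-top-profile : ℕ → ℕ → ℕ
twin-top-profile q i = δ (2 + q) i + δ (2 + q) i + δ 0 i + δ (1 + q) i + δ 1 i

twin-top-profile-top : ∀ q → twin-top-profile q (2 + q) ≡ 2
twin-top-profile-top q rewrite δ-refl (2 + q) | δ≡0 {0} {2 + q} (λ ()) | δ≡0 (<⇒≢ (n<1+n (1 + q)))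
  | δ≡0 {1} {2 + q} (λ ()) = refl

twin-top-profile≤2 : ∀ q i → twin-top-profile q i ≤ 2
twin-top-profile≤2 q i with i ≟ 2 + q
... | yes refl = ≤-reflexive (twin-top-profile-top q)
... | no i≢2+q rewrite δ≡0 (≢-sym i≢2+q) = +-mono-≤ (δ+δ≤1 0 (1 + q) i (λ ())) (δ≤1 1 i)

twin-top-profile-above : ∀ q i → 2 + q < i → twin-top-profile q i ≡ 0
twin-top-profile-above q i 2+q<i rewrite δ≡0 (<⇒≢ 2+q<i) | δ≡0 {0} {i} (<⇒≢ (≤-trans (s≤s z≤n) 2+q<i))
  | δ≡0 (<⇒≢ (<-trans (n<1+n (1 + q)) 2+q<i)) | δ≡0 {1} {i} (<⇒≢ (≤-trans (s≤s (s≤s z≤n)) 2+q<i)) = refl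

twin-top-profile-below : ∀ q i → i < 1 + q → twin-top-profile q i ≤ 1
twin-top-profile-below q i i<1+q rewrite δ≡0 (≢-sym (<⇒≢ (m<n⇒m<1+n i<1+q))) | δ≡0 (≢-sym (<⇒≢ i<1+q)) =
  subst (_≤ 1) (cong (_+ δ 1 i) (sym (+-identityʳ (δ 0 i)))) (δ+δ≤1 0 1 i (λ ()))

module _ (t : ℕ) where

  Balanced : Triple → Set
  Balanced T = total T ≡ 3 * t

  record Symmetric (c : ℕ → ℕ) : Set where
    field
      mirror : ∀ i → i ≤ t → c (t + i) ≡ c (t ∸ i)

  record Steep (s : ℕ) (c : ℕ → ℕ) : Set where
    field
      vanishes : ∀ j → s < j → j ≤ t → c (t + j) ≡ 0
      gaps : ∀ i → i < s → c (t + suc i) + s ≤ c (t + i)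

  size : (ℕ → ℕ) → ℕ
  size c = ∑< (suc (t + t)) c

  level-elim : (Q : ℕ → Set) → (∀ i → Q (t + i)) → (∀ i → i ≤ t → Q (t ∸ i)) → ∀ k → Q k
  level-elim Q above below k with t ≤? k
  ... | yes t≤k = subst Q (m+[n∸m]≡n t≤k) (above (k ∸ t))
  ... | no t≰k = subst Q (m∸[m∸n]≡n (<⇒≤ (≰⇒> t≰k))) (below (t ∸ k) (m∸n≤m t k))

  record Pattern (φ : ℕ → ℕ) : Set where
    field
      triples : List Triple
      balanced : All Balanced triples
      occ-above : ∀ i → occ triples (t + i) ≡ φ i
      occ-below : ∀ i → i ≤ t → occ triples (t ∸ i) ≡ φ i

  record Plan (p : ℕ) (c : ℕ → ℕ) : Set where
    field
      triples : List Triple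
      length-triples : length triples ≡ p
      balanced : All Balanced triples
      within : ∀ k → occ triples k ≤ c k
      symmetric : ∀ i → i ≤ t → occ triples (t + i) ≡ occ triples (t ∸ i)

  empty-plan : ∀ c → Plan 0 c
  empty-plan c = record
    { triples = [] ; length-triples = refl ; balanced = [] ; within = λ _ → z≤n ; symmetric = λ _ _ → refl }

  residual : (ℕ → ℕ) → List Triple → ℕ → ℕ
  residual c C k = c k ∸ occ C k

  module _ {φ c} (c-sym : Symmetric c) (P : Pattern φ) (φ≤c : ∀ i → φ i ≤ c (t + i)) where
    open Pattern P

    occ≤ : ∀ k → occ triples k ≤ c k
    occ≤ = level-elim (λ k → occ triples k ≤ c k)
      (λ i → subst (_≤ c (t + i)) (sym (occ-above i)) (φ≤c i))
      (λ i i≤t → subst₂ _≤_ (sym (occ-below i i≤t)) (Symmetric.mirror c-sym i i≤t) (φ≤c i))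

    residual-above : ∀ i → residual c triples (t + i) ≡ c (t + i) ∸ φ i
    residual-above i = cong (c (t + i) ∸_) (occ-above i)

    residual-symmetric : Symmetric (residual c triples)
    residual-symmetric = record
      { mirror = λ i i≤t → cong₂ _∸_ (Symmetric.mirror c-sym i i≤t) (trans (occ-above i) (sym (occ-below i i≤t))) }

    size-residual : ∀ p → 3 * p ≤ size c → 3 * (p ∸ length triples) ≤ size (residual c triples)
    size-residual p 3p≤size = begin
      3 * (p ∸ length triples)              ≡⟨ *-distribˡ-∸ 3 p (length triples) ⟩
      3 * p ∸ 3 * length triples            ≤⟨ ∸-monoˡ-≤ (3 * length triples) 3p≤size ⟩
      size c ∸ 3 * length triples           ≤⟨ ∸-monoʳ-≤ (size c) used≤ ⟩
      size c ∸ used                         ≡⟨ cong (_∸ used) size-split ⟩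
      size (residual c triples) + used ∸ used ≡⟨ m+n∸n≡m (size (residual c triples)) used ⟩
      size (residual c triples)             ∎
      where
      open ≤-Reasoning
      N = suc (t + t)
      used = ∑< N (occ triples)
      used≤ : used ≤ 3 * length triples
      used≤ = ≤-trans (∑<-count≤length N (levels triples)) (≤-reflexive (length-levels triples))
      size-split : size c ≡ size (residual c triples) + used
      size-split = trans (∑<-cong N (λ k → sym (m∸n+n≡m (occ≤ k)))) (∑<-distrib-+ N (residual c triples) (occ triples))

    extend : ∀ p → length triples ≤ p → Plan (p ∸ length triples) (residual c triples) → Plan p c
    extend p length≤p Q = record
      { triples = triples ++ Q.triples
      ; length-triples = trans (length-++ triples) (trans (cong (length triples +_) Q.length-triples) (m+[n∸m]≡n length≤p))
      ; balanced = ++⁺ balanced Q.balanced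
      ; within = within
      ; symmetric = symmetric
      }
      where
      module Q = Plan Q
      within : ∀ k → occ (triples ++ Q.triples) k ≤ c k
      within k = begin
        occ (triples ++ Q.triples) k                 ≡⟨ occ-++ triples Q.triples k ⟩
        occ triples k + occ Q.triples k              ≤⟨ +-monoʳ-≤ (occ triples k) (Q.within k) ⟩
        occ triples k + (c k ∸ occ triples k)        ≡⟨ m+[n∸m]≡n (occ≤ k) ⟩
        c k                                          ∎
        where open ≤-Reasoning
      symmetric : ∀ i → i ≤ t → occ (triples ++ Q.triples) (t + i) ≡ occ (triples ++ Q.triples) (t ∸ i)
      symmetric i i≤t = begin
        occ (triples ++ Q.triples) (t + i)           ≡⟨ occ-++ triples Q.triples (t + i) ⟩
        occ triples (t + i) + occ Q.triples (t + i)  ≡⟨ cong₂ _+_ (trans (occ-above i) (sym (occ-below i i≤t))) (Q.symmetric i i≤t) ⟩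
        occ triples (t ∸ i) + occ Q.triples (t ∸ i)  ≡⟨ occ-++ triples Q.triples (t ∸ i) ⟨
        occ (triples ++ Q.triples) (t ∸ i)           ∎
        where open ≡-Reasoning

    pattern-plan : ∀ p → length triples ≡ p → Plan p c
    pattern-plan p length≡p = record
      { triples = triples ; length-triples = length≡p ; balanced = balanced ; within = occ≤
      ; symmetric = λ i i≤t → trans (occ-above i) (sym (occ-below i i≤t)) }

  module _ {s c} (steep : Steep s c) where

    steep-gap : ∀ d i → i + d ≤ s → c (t + (i + d)) + d * s ≤ c (t + i)
    steep-gap zero i _ rewrite +-identityʳ i | +-identityʳ (c (t + i)) = ≤-refl
    steep-gap (suc d) i i+1+d≤s = begin
      c (t + (i + suc d)) + (s + d * s)  ≡⟨ cong (λ j → c (t + j) + (s + d * s)) (+-suc i d) ⟩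
      c (t + suc (i + d)) + (s + d * s)  ≡⟨ +-assoc (c (t + suc (i + d))) s (d * s) ⟨
      c (t + suc (i + d)) + s + d * s    ≤⟨ +-monoˡ-≤ (d * s) (Steep.gaps steep (i + d) i+d<s) ⟩
      c (t + (i + d)) + d * s            ≤⟨ steep-gap d i (<⇒≤ i+d<s) ⟩
      c (t + i)                          ∎
      where
      open ≤-Reasoning
      i+d<s : i + d < s
      i+d<s = subst (_≤ s) (+-suc i d) i+1+d≤s

    steep-antitone : ∀ {i j} → i ≤ j → j ≤ s → c (t + j) ≤ c (t + i)
    steep-antitone {i} {j} i≤j j≤s = begin
      c (t + j)                            ≡⟨ cong (λ k → c (t + k)) (m+[n∸m]≡n i≤j) ⟨
      c (t + (i + (j ∸ i)))                ≤⟨ m≤m+n _ _ ⟩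
      c (t + (i + (j ∸ i))) + (j ∸ i) * s  ≤⟨ steep-gap (j ∸ i) i (subst (_≤ s) (sym (m+[n∸m]≡n i≤j)) j≤s) ⟩
      c (t + i)                            ∎
      where open ≤-Reasoning

    profile-fits : ∀ {φ : ℕ → ℕ} K → K ≤ c (t + s) → (∀ i → φ i ≤ K) → (∀ i → s < i → φ i ≡ 0) → ∀ i → φ i ≤ c (t + i)
    profile-fits K K≤top φ≤K φ-vanishes i with i ≤? s
    ... | yes i≤s = ≤-trans (φ≤K i) (≤-trans K≤top (steep-antitone i≤s ≤-refl))
    ... | no i≰s = subst (_≤ c (t + i)) (sym (φ-vanishes i (≰⇒> i≰s))) z≤n

  steep-descend : ∀ {r c c′} → Steep (suc r) c → (∀ j → c′ (t + j) ≤ c (t + j)) →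
                  (∀ i → i < r → c (t + i) ≤ suc (c′ (t + i))) → c′ (t + suc r) ≡ 0 → Steep r c′
  steep-descend {r} {c} {c′} steep c′≤c c≤1+c′ top-empty = record { vanishes = vanish′ ; gaps = gap′ }
    where
    open Steep steep
    vanish′ : ∀ j → r < j → j ≤ t → c′ (t + j) ≡ 0
    vanish′ j r<j j≤t with j ≟ suc r
    ... | yes refl = top-empty
    ... | no j≢1+r = n≤0⇒n≡0 (≤-trans (c′≤c j) (≤-reflexive (vanishes j (≤∧≢⇒< r<j (≢-sym j≢1+r)) j≤t)))
    gap′ : ∀ i → i < r → c′ (t + suc i) + r ≤ c′ (t + i)
    gap′ i i<r = ≤-pred (begin
      suc (c′ (t + suc i) + r)  ≡⟨ +-suc (c′ (t + suc i)) r ⟨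
      c′ (t + suc i) + suc r    ≤⟨ +-monoˡ-≤ (suc r) (c′≤c (suc i)) ⟩
      c (t + suc i) + suc r     ≤⟨ gaps i (m<n⇒m<1+n i<r) ⟩
      c (t + i)                 ≤⟨ c≤1+c′ i i<r ⟩
      suc (c′ (t + i))          ∎)
      where open ≤-Reasoning

  copies : ∀ (φ : ℕ → ℕ) q T → Balanced T → (∀ i → occ (T ∷ []) (t + i) ≡ φ i) →
           (∀ i → i ≤ t → occ (T ∷ []) (t ∸ i) ≡ φ i) → Pattern (λ i → q * φ i)
  copies φ q T balanced above below = record
    { triples = replicate q T
    ; balanced = replicate⁺ q balanced
    ; occ-above = λ i → trans (occ-replicate q T (t + i)) (cong (q *_) (above i))
    ; occ-below = λ i i≤t → trans (occ-replicate q T (t ∸ i)) (cong (q *_) (below i i≤t)) }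

  centre : ∀ q → Pattern (λ i → q * (3 * δ 0 i))
  centre q = copies (λ i → 3 * δ 0 i) q (t , t , t) (m+m+m≡3*m t) above below
    where
    above : ∀ i → occ ((t , t , t) ∷ []) (t + i) ≡ 3 * δ 0 i
    above i rewrite δ-centre-+ t i = refl
    below : ∀ i → i ≤ t → occ ((t , t , t) ∷ []) (t ∸ i) ≡ 3 * δ 0 i
    below i i≤t rewrite δ-centre-∸ i≤t = refl

  spread-balanced : ∀ {a} → a ≤ t → Balanced (t + a , t ∸ a , t)
  spread-balanced {a} a≤t = begin
    t + a + (t ∸ a) + t    ≡⟨ cong (_+ t) (+-assoc t a (t ∸ a)) ⟩
    t + (a + (t ∸ a)) + t  ≡⟨ cong (λ x → t + x + t) (m+[n∸m]≡n a≤t) ⟩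
    t + t + t              ≡⟨ m+m+m≡3*m t ⟩
    3 * t                  ∎
    where
    open ≡-Reasoning

  spread : ∀ q a → 1 ≤ a → a ≤ t → Pattern (λ i → q * (δ a i + δ 0 i))
  spread q a 1≤a a≤t = copies (λ i → δ a i + δ 0 i) q (t + a , t ∸ a , t) (spread-balanced a≤t) above below
    where
    above : ∀ i → occ ((t + a , t ∸ a , t) ∷ []) (t + i) ≡ δ a i + δ 0 i
    above i rewrite δ-cancelˡ-+ t a i | δ-below-above i 1≤a a≤t | δ-centre-+ t i =
      cong (δ a i +_) (+-identityʳ (δ 0 i))
    below : ∀ i → i ≤ t → occ ((t + a , t ∸ a , t) ∷ []) (t ∸ i) ≡ δ a i + δ 0 i
    below i i≤t rewrite δ-above-below {t} i 1≤a | δ-cancelˡ-∸ a≤t i≤t | δ-centre-∸ i≤t =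
      cong (δ a i +_) (+-identityʳ (δ 0 i))

  twin-top-triples : ℕ → List Triple
  twin-top-triples q = (t + s , t ∸ s , t) ∷ (t + s , t ∸ r , t ∸ 1) ∷ (t ∸ s , t + r , t + 1) ∷ []
    where
    s = 2 + q
    r = 1 + q

  twin-top-balanced : ∀ q → 2 + q ≤ t → All Balanced (twin-top-triples q)
  twin-top-balanced q s≤t = spread-balanced s≤t ∷ balanced₂ ∷ balanced₃ ∷ []
    where
    s = 2 + q
    r = 1 + q
    balanced₂ : Balanced (t + s , t ∸ r , t ∸ 1)
    balanced₂ = begin
      t + s + (t ∸ r) + (t ∸ 1)            ≡⟨ regroup t (t ∸ r) (t ∸ 1) q ⟩
      t + (t ∸ r + r) + (t ∸ 1 + 1)        ≡⟨ cong₂ (λ x y → t + x + y) (m∸n+n≡m (≤-trans (n≤1+n r) s≤t))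
                                                                      (m∸n+n≡m (≤-trans (s≤s z≤n) s≤t)) ⟩
      t + t + t                            ≡⟨ m+m+m≡3*m t ⟩
      3 * t                                ∎
      where
      open ≡-Reasoning
      regroup : ∀ t x y q → t + (2 + q) + x + y ≡ t + (x + (1 + q)) + (y + 1)
      regroup = solve-∀
    balanced₃ : Balanced (t ∸ s , t + r , t + 1)
    balanced₃ = begin
      t ∸ s + (t + r) + (t + 1)            ≡⟨ regroup t (t ∸ s) q ⟩
      (t ∸ s + s) + t + t                  ≡⟨ cong (λ x → x + t + t) (m∸n+n≡m s≤t) ⟩
      t + t + t                            ≡⟨ m+m+m≡3*m t ⟩
      3 * t                                ∎
      where
      open ≡-Reasoning
      regroup : ∀ t x q → x + (t + (1 + q)) + (t + 1) ≡ (x + (2 + q)) + t + t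
      regroup = solve-∀

  twin-top : ∀ q → 2 + q ≤ t → Pattern (twin-top-profile q)
  twin-top q s≤t = record
    { triples = twin-top-triples q
    ; balanced = twin-top-balanced q s≤t
    ; occ-above = λ i → trans (above i) (shuffle-above (δ s i) (δ 0 i) (δ r i) (δ 1 i))
    ; occ-below = λ i i≤t → trans (below i i≤t) (shuffle-below (δ s i) (δ 0 i) (δ r i) (δ 1 i)) }
    where
    s = 2 + q
    r = 1 + q
    r≤t : r ≤ t
    r≤t = ≤-trans (n≤1+n r) s≤t
    1≤t : 1 ≤ t
    1≤t = ≤-trans (s≤s z≤n) s≤t
    above : ∀ i → occ (twin-top-triples q) (t + i)
                ≡ δ s i + (0 + (δ 0 i + (δ s i + (0 + (0 + (0 + (δ r i + (δ 1 i + 0))))))))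
    above i rewrite δ-cancelˡ-+ t s i | δ-below-above {t} {s} i (s≤s z≤n) s≤t | δ-centre-+ t i
      | δ-below-above {t} {r} i (s≤s z≤n) r≤t | δ-below-above {t} {1} i ≤-refl 1≤t
      | δ-cancelˡ-+ t r i | δ-cancelˡ-+ t 1 i = refl
    below : ∀ i → i ≤ t → occ (twin-top-triples q) (t ∸ i)
                ≡ 0 + (δ s i + (δ 0 i + (0 + (δ r i + (δ 1 i + (δ s i + (0 + (0 + 0))))))))
    below i i≤t rewrite δ-above-below {t} {s} i (s≤s z≤n) | δ-cancelˡ-∸ s≤t i≤t | δ-centre-∸ i≤t
      | δ-cancelˡ-∸ r≤t i≤t | δ-cancelˡ-∸ 1≤t i≤t | δ-above-below {t} {r} i (s≤s z≤n) | δ-above-below {t} {1} i ≤-refl = refl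
    shuffle-above : ∀ a b d e → a + (0 + (b + (a + (0 + (0 + (0 + (d + (e + 0)))))))) ≡ a + a + b + d + e
    shuffle-above = solve-∀
    shuffle-below : ∀ a b d e → 0 + (a + (b + (0 + (d + (e + (a + (0 + (0 + 0)))))))) ≡ a + a + b + d + e
    shuffle-below = solve-∀

  block-profile : ℕ → ℕ → ℕ
  block-profile r i = 3 * inInterval (t + i) (t ∸ suc r) (3 + (r + r))

  module _ (r : ℕ) (1+r≤t : suc r ≤ t) where
    private
      s = suc r
      b = t ∸ s
      n = 3 + (r + r)
      b+n≡ : b + n ≡ suc (t + s)
      b+n≡ = trans (regroup b r) (cong (λ x → suc (x + s)) (m∸n+n≡m 1+r≤t))
        where
        regroup : ∀ x r → x + (3 + (r + r)) ≡ suc (x + suc r + suc r)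
        regroup = solve-∀

      inside-above : ∀ i → i ≤ s → inInterval (t + i) b n ≡ 1
      inside-above i i≤s = inInterval-inside (t + i) b n (≤-trans (m∸n≤m t s) (m≤m+n t i))
        (≤-trans (s≤s (+-monoʳ-≤ t i≤s)) (≤-reflexive (sym b+n≡)))

      outside-above : ∀ i → s < i → inInterval (t + i) b n ≡ 0
      outside-above i s<i = inInterval-above (t + i) b n
        (≤-trans (≤-reflexive b+n≡) (≤-trans (≤-reflexive (sym (+-suc t s))) (+-monoʳ-≤ t s<i)))

      mirror : ∀ i → i ≤ t → inInterval (t ∸ i) b n ≡ inInterval (t + i) b n
      mirror i i≤t with i ≤? s
      ... | yes i≤s = trans (inInterval-inside (t ∸ i) b n (∸-monoʳ-≤ t i≤s)
                               (≤-trans (s≤s (m∸n≤m t i)) (≤-trans (s≤s (m≤m+n t s)) (≤-reflexive (sym b+n≡)))))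
                            (sym (inside-above i i≤s))
      ... | no i≰s = trans (inInterval-below (t ∸ i) b n (∸-monoʳ-< {t} {i} {s} (≰⇒> i≰s) i≤t))
                           (sym (outside-above i (≰⇒> i≰s)))

    block-profile-inside : ∀ i → i ≤ suc r → block-profile r i ≡ 3
    block-profile-inside i i≤s = cong (3 *_) (inside-above i i≤s)

    block-profile-outside : ∀ i → suc r < i → block-profile r i ≡ 0
    block-profile-outside i s<i = cong (3 *_) (outside-above i s<i)

    centred-block : Pattern (block-profile r)
    centred-block = record
      { triples = block b r
      ; balanced = All.map (λ total≡ → trans total≡ (cong (3 *_) (m∸n+n≡m 1+r≤t))) (block-total b r)
      ; occ-above = λ i → occ-block (t + i) b r
      ; occ-below = λ i i≤t → trans (occ-block (t ∸ i) b r) (cong (3 *_) (mirror i i≤t)) }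

  residual-descends : ∀ {r c φ} (P : Pattern φ) → Steep (suc r) c → (∀ i → i < r → φ i ≤ 1) →
                      φ (suc r) ≡ c (t + suc r) → Steep r (residual c (Pattern.triples P))
  residual-descends {r} {c} {φ} P steep φ≤1 top = steep-descend steep
    (λ j → subst (_≤ c (t + j)) (sym (residual-above′ j)) (m∸n≤m (c (t + j)) (φ j)))
    (λ i i<r → subst (c (t + i) ≤_) (cong suc (sym (residual-above′ i))) (m≤1+m∸n (c (t + i)) (φ≤1 i i<r)))
    (trans (residual-above′ (suc r)) (trans (cong (c (t + suc r) ∸_) top) (n∸n≡0 (c (t + suc r)))))
    where
    residual-above′ : ∀ i → residual c (Pattern.triples P) (t + i) ≡ c (t + i) ∸ φ i
    residual-above′ i = cong (c (t + i) ∸_) (Pattern.occ-above P i)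

  -- The block takes exactly three edges from every level up to the top one, so the gaps survive.
  residual-block : ∀ {r c} (1+r≤t : suc r ≤ t) → Steep (suc r) c → 3 ≤ c (t + suc r) →
                   Steep (suc r) (residual c (Pattern.triples (centred-block r 1+r≤t)))
  residual-block {r} {c} 1+r≤t steep 3≤top = record { vanishes = vanish ; gaps = gap }
    where
    s = suc r
    residual-above′ : ∀ i → residual c (Pattern.triples (centred-block r 1+r≤t)) (t + i) ≡ c (t + i) ∸ block-profile r i
    residual-above′ i = cong (c (t + i) ∸_) (Pattern.occ-above (centred-block r 1+r≤t) i)
    vanish : ∀ j → s < j → j ≤ t → residual c (Pattern.triples (centred-block r 1+r≤t)) (t + j) ≡ 0
    vanish j s<j j≤t = trans (residual-above′ j) (trans (cong (_∸ block-profile r j) (Steep.vanishes steep j s<j j≤t)) (0∸n≡0 (block-profile r j)))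
    gap : ∀ i → i < s → residual c (Pattern.triples (centred-block r 1+r≤t)) (t + suc i) + s
                        ≤ residual c (Pattern.triples (centred-block r 1+r≤t)) (t + i)
    gap i i<s rewrite residual-above′ (suc i) | residual-above′ i
      | block-profile-inside r 1+r≤t (suc i) i<s | block-profile-inside r 1+r≤t i (<⇒≤ i<s) = begin
      c (t + suc i) ∸ 3 + s  ≡⟨ +-∸-comm s (≤-trans 3≤top (steep-antitone steep i<s ≤-refl)) ⟨
      c (t + suc i) + s ∸ 3  ≤⟨ ∸-monoˡ-≤ 3 (Steep.gaps steep i i<s) ⟩
      c (t + i) ∸ 3          ∎
      where open ≤-Reasoning

  record Feasible (s p : ℕ) (c : ℕ → ℕ) : Set where
    field
      s≤t : s ≤ t
      c-symmetric : Symmetric c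
      c-steep : Steep s c
      enough : 3 * p ≤ size c

  Planner : ℕ → Set
  Planner f = ∀ {s p c} → Feasible s p c → s + p ≤ f → Plan p c

  step : ∀ {f s s′ p c φ} → Planner f → Feasible s p c → s + p ≤ suc f →
         (P : Pattern φ) → (∀ i → φ i ≤ c (t + i)) →
         1 ≤ length (Pattern.triples P) → length (Pattern.triples P) ≤ p →
         s′ ≤ s → Steep s′ (residual c (Pattern.triples P)) → Plan p c
  step {p = p} rec F fuel P fits 1≤length length≤p s′≤s steep′ =
    extend c-symmetric P fits p length≤p (rec feasible′ (fuel-step s′≤s 1≤length length≤p fuel))
    where
    open Feasible F
    feasible′ = record
      { s≤t = ≤-trans s′≤s s≤t
      ; c-symmetric = residual-symmetric c-symmetric P fits
      ; c-steep = steep′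
      ; enough = size-residual c-symmetric P fits p enough }

  plan-flat : ∀ {p c} → Feasible 0 p c → Plan p c
  plan-flat {p} {c} F = pattern-plan c-symmetric (centre p) fits p (length-replicate p)
    where
    open Feasible F
    off-centre : ∀ k → k < suc (t + t) → k ≢ t → c k ≡ 0
    off-centre = level-elim (λ k → k < suc (t + t) → k ≢ t → c k ≡ 0)
      (λ i t+i<N t+i≢t → Steep.vanishes c-steep i (n≢0⇒n>0 (λ i≡0 → t+i≢t (trans (cong (t +_) i≡0) (+-identityʳ t))))
                                                  (+-cancelˡ-≤ t i t (≤-pred t+i<N)))
      (λ i i≤t _ t∸i≢t → trans (sym (Symmetric.mirror c-symmetric i i≤t))
                               (Steep.vanishes c-steep i (n≢0⇒n>0 (λ i≡0 → t∸i≢t (cong (t ∸_) i≡0))) i≤t))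
    fits : ∀ i → p * (3 * δ 0 i) ≤ c (t + i)
    fits zero = subst₂ _≤_ (*-comm 3 p) (cong c (sym (+-identityʳ t)))
                       (≤-trans enough (∑<-≤-single (suc (t + t)) t c off-centre))
    fits (suc i) rewrite *-zeroʳ p = z≤n

  plan-shallow : ∀ {r p c} → Feasible (suc r) p c → p ≤ c (t + 1) → Plan p c
  plan-shallow {p = p} {c} F p≤c₁ = pattern-plan c-symmetric (spread p 1 ≤-refl (≤-trans (s≤s z≤n) s≤t)) fits p (length-replicate p)
    where
    open Feasible F
    fits : ∀ i → p * (δ 1 i + δ 0 i) ≤ c (t + i)
    fits zero rewrite *-identityʳ p = ≤-trans p≤c₁ (steep-antitone c-steep z≤n (s≤s z≤n))
    fits (suc zero) rewrite *-identityʳ p = p≤c₁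
    fits (suc (suc i)) rewrite *-zeroʳ p = z≤n

  plan-empty-top : ∀ {f r p c} → Planner f → Feasible (suc r) p c → suc r + p ≤ suc f → c (t + suc r) ≡ 0 → Plan p c
  plan-empty-top {r = r} rec F fuel top≡0 = rec feasible′ (≤-pred fuel)
    where
    open Feasible F
    feasible′ = record
      { s≤t = ≤-trans (n≤1+n r) s≤t
      ; c-symmetric = c-symmetric
      ; c-steep = steep-descend c-steep (λ _ → ≤-refl) (λ _ _ → n≤1+n _) top≡0
      ; enough = enough }

  plan-single-top : ∀ {f r p c} → Planner f → Feasible (suc r) (suc p) c → suc r + suc p ≤ suc f →
                    c (t + suc r) ≡ 1 → Plan (suc p) c
  plan-single-top {r = r} {c = c} rec F fuel top≡1 =
    step rec F fuel P fits ≤-refl (s≤s z≤n) (n≤1+n r) (residual-descends P c-steep (λ i _ → profile≤1 i) top)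
    where
    open Feasible F
    s = suc r
    P = spread 1 s (s≤s z≤n) s≤t
    profile≤1 : ∀ i → 1 * (δ s i + δ 0 i) ≤ 1
    profile≤1 i = subst (_≤ 1) (sym (*-identityˡ _)) (δ+δ≤1 s 0 i (λ ()))
    profile-vanishes : ∀ i → s < i → 1 * (δ s i + δ 0 i) ≡ 0
    profile-vanishes i s<i rewrite δ≡0 (<⇒≢ s<i) | δ≡0 {0} {i} (<⇒≢ (≤-trans (s≤s z≤n) s<i)) = refl
    fits : ∀ i → 1 * (δ s i + δ 0 i) ≤ c (t + i)
    fits = profile-fits c-steep 1 (≤-reflexive (sym top≡1)) profile≤1 profile-vanishes
    top : 1 * (δ s s + δ 0 s) ≡ c (t + s)
    top rewrite δ-refl s = sym top≡1

  plan-twin-top : ∀ {f r p c} → Planner f → Feasible (suc r) p c → suc r + p ≤ suc f →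
                  c (t + 1) < p → c (t + suc r) ≡ 2 → Plan p c
  plan-twin-top {r = zero} {c = c} rec F fuel deep top≡2 =
    step rec F fuel P fits (s≤s z≤n) (<⇒≤ (≤-<-trans (≤-reflexive (sym top≡2)) deep)) z≤n
         (residual-descends {r = 0} P c-steep (λ _ ()) (sym top≡2))
    where
    open Feasible F
    P = spread 2 1 ≤-refl s≤t
    profile≤2 : ∀ i → 2 * (δ 1 i + δ 0 i) ≤ 2
    profile≤2 i = *-monoʳ-≤ 2 (δ+δ≤1 1 0 i (λ ()))
    profile-vanishes : ∀ i → 1 < i → 2 * (δ 1 i + δ 0 i) ≡ 0
    profile-vanishes (suc zero) (s≤s ())
    profile-vanishes (suc (suc i)) _ = refl
    fits : ∀ i → 2 * (δ 1 i + δ 0 i) ≤ c (t + i)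
    fits = profile-fits c-steep 2 (≤-reflexive (sym top≡2)) profile≤2 profile-vanishes
  plan-twin-top {r = suc q} {p} {c} rec F fuel deep top≡2 =
    step rec F fuel P fits (s≤s z≤n) 3≤p (n≤1+n (suc q))
         (residual-descends P c-steep (twin-top-profile-below q) (trans (twin-top-profile-top q) (sym top≡2)))
    where
    open Feasible F
    P = twin-top q s≤t
    fits : ∀ i → twin-top-profile q i ≤ c (t + i)
    fits = profile-fits c-steep 2 (≤-reflexive (sym top≡2)) (twin-top-profile≤2 q) (twin-top-profile-above q)
    3≤p : 3 ≤ p
    3≤p = ≤-trans (s≤s (≤-trans (≤-reflexive (sym top≡2)) (steep-antitone c-steep (s≤s z≤n) ≤-refl))) deep

  plan-block : ∀ {f r p c} → Planner f → Feasible (suc r) p c → suc r + p ≤ suc f →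
               c (t + 1) < p → 3 ≤ c (t + suc r) → Plan p c
  plan-block {r = r} {p} {c} rec F fuel deep 3≤top =
    step rec F fuel (centred-block r s≤t) fits (s≤s z≤n) length≤p ≤-refl (residual-block s≤t c-steep 3≤top)
    where
    open Feasible F
    profile≤3 : ∀ i → block-profile r i ≤ 3
    profile≤3 i with i ≤? suc r
    ... | yes i≤s = ≤-reflexive (block-profile-inside r s≤t i i≤s)
    ... | no i≰s = subst (_≤ 3) (sym (block-profile-outside r s≤t i (≰⇒> i≰s))) z≤n
    fits : ∀ i → block-profile r i ≤ c (t + i)
    fits = profile-fits c-steep 3 3≤top profile≤3 (block-profile-outside r s≤t)
    r+r≤r*[1+r] : r + r ≤ r * suc r
    r+r≤r*[1+r] = subst (r + r ≤_) (sym (*-suc r r)) (+-monoʳ-≤ r (r≤r*r r))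
      where
      r≤r*r : ∀ r → r ≤ r * r
      r≤r*r zero = z≤n
      r≤r*r (suc r) = m≤m*n (suc r) (suc r)
    length≤p : length (block (t ∸ suc r) r) ≤ p
    length≤p = begin
      length (block (t ∸ suc r) r)   ≡⟨ length-block (t ∸ suc r) r ⟩
      3 + (r + r)                    ≤⟨ +-mono-≤ 3≤top r+r≤r*[1+r] ⟩
      c (t + suc r) + r * suc r      ≤⟨ steep-gap c-steep r 1 ≤-refl ⟩
      c (t + 1)                      <⟨ deep ⟩
      p                              ∎
      where open ≤-Reasoning

  plan : ∀ f → Planner f
  plan f {p = zero} {c} _ _ = empty-plan c
  plan zero {s} {suc p} _ fuel = ⊥-elim (n≮0 (≤-trans (m≤n+m (suc p) s) fuel))
  plan (suc f) {zero} {suc p} F _ = plan-flat F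
  plan (suc f) {suc r} {suc p} {c} F fuel with suc p ≤? c (t + 1)
  ... | yes shallow = plan-shallow F shallow
  ... | no deep with c (t + suc r) in top
  ...   | 0 = plan-empty-top (plan f) F fuel top
  ...   | 1 = plan-single-top (plan f) F fuel top
  ...   | 2 = plan-twin-top (plan f) F fuel (≰⇒> deep) top
  ...   | suc (suc (suc _)) = plan-block (plan f) F fuel (≰⇒> deep) (≤-trans (s≤s (s≤s (s≤s z≤n))) (≤-reflexive (sym top)))

  steep-level : ∀ {c} (e : ℕ → ℕ) → (∀ i → i ≤ t → c (t + i) ≡ e i) →
                (∀ s → s ≤ t → 0 < e s → (∀ j → s < j → j ≤ t → e j ≡ 0) → ∀ i → i < s → e (1 + i) + s ≤ e i) →
                Σ ℕ λ s → s ≤ t × Steep s c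
  steep-level {c} e c≡e gapped = search t ≤-refl (λ j t<j j≤t → ⊥-elim (<-irrefl refl (<-≤-trans t<j j≤t)))
    where
    search : ∀ u → u ≤ t → (∀ j → u < j → j ≤ t → e j ≡ 0) → Σ ℕ λ s → s ≤ t × Steep s c
    search zero _ empty-above = 0 , z≤n , record
      { vanishes = λ j 0<j j≤t → trans (c≡e j j≤t) (empty-above j 0<j j≤t) ; gaps = λ _ () }
    search (suc u) 1+u≤t empty-above with e (suc u) ≟ 0
    ... | yes e≡0 = search u (≤-trans (n≤1+n u) 1+u≤t) empty-above′
      where
      empty-above′ : ∀ j → u < j → j ≤ t → e j ≡ 0
      empty-above′ j u<j j≤t with j ≟ suc u
      ... | yes refl = e≡0
      ... | no j≢1+u = empty-above j (≤∧≢⇒< u<j (≢-sym j≢1+u)) j≤t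
    ... | no e≢0 = suc u , 1+u≤t , record
      { vanishes = λ j 1+u<j j≤t → trans (c≡e j j≤t) (empty-above j 1+u<j j≤t)
      ; gaps = λ i i<1+u → subst₂ (λ a b → a + suc u ≤ b)
                 (sym (c≡e (suc i) (≤-trans i<1+u 1+u≤t))) (sym (c≡e i (≤-trans (n≤1+n i) (≤-trans i<1+u 1+u≤t))))
                 (gapped (suc u) 1+u≤t (n≢0⇒n>0 e≢0) empty-above i i<1+u) }

-- Realizing a level plan by edges

module _ {n} (Y : Subset n) where

  meets : Subset n × Subset n × Subset n → Triple
  meets (E₁ , E₂ , E₃) = meet Y E₁ , meet Y E₂ , meet Y E₃

  map-meet-flatten : ∀ T → map (meet Y) (flatten T) ≡ levels (map meets T)
  map-meet-flatten [] = refl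
  map-meet-flatten ((E₁ , E₂ , E₃) ∷ T) = cong (λ l → meet Y E₁ ∷ meet Y E₂ ∷ meet Y E₃ ∷ l) (map-meet-flatten T)

  regroup : ∀ ts (L : List (Subset n)) → map (meet Y) L ≡ levels ts →
            Σ (List (Subset n × Subset n × Subset n)) λ T → flatten T ≡ L × map meets T ≡ ts
  regroup [] [] refl = [] , refl , refl
  regroup ((a , b , c) ∷ ts) (E₁ ∷ E₂ ∷ E₃ ∷ L) eq with regroup ts L (∷-injectiveʳ (∷-injectiveʳ (∷-injectiveʳ eq)))
  ... | T , flatten≡L , meets≡ts =
    (E₁ , E₂ , E₃) ∷ T , cong (λ l → E₁ ∷ E₂ ∷ E₃ ∷ l) flatten≡L , cong₂ _∷_ meets≡abc meets≡ts
    where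
    meets≡abc : meets (E₁ , E₂ , E₃) ≡ (a , b , c)
    meets≡abc with refl ← ∷-injectiveˡ eq | refl ← ∷-injectiveˡ (∷-injectiveʳ eq)
                 | refl ← ∷-injectiveˡ (∷-injectiveʳ (∷-injectiveʳ eq)) = refl

  select-triples : ∀ ts (edges : List (Subset n)) → Unique edges → (∀ k → occ ts k ≤ countAt Y edges k) →
                   Σ (List (Subset n × Subset n × Subset n)) λ T →
                     map meets T ≡ ts × Unique (flatten T) × All (_∈ edges) (flatten T)
  select-triples ts edges edges-unique occ≤count
    with L , meets≡levels , L-unique , L⊆edges ← realize (meet Y) (levels ts) edges edges-unique
           (λ k → subst (occ ts k ≤_) (length-filter≡count (meet Y) k edges) (occ≤count k))
    with T , flatten≡L , meets≡ts ← regroup ts L meets≡levels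
    = T , meets≡ts , subst Unique (sym flatten≡L) L-unique , subst (All (_∈ edges)) (sym flatten≡L) L⊆edges

  countAt-flatten : ∀ T k → countAt Y (flatten T) k ≡ occ (map meets T) k
  countAt-flatten T k = trans (length-filter≡count (meet Y) k (flatten T)) (cong (count k) (map-meet-flatten T))

  size-countAt : ∀ t (edges : List (Subset n)) → All (λ E → ∣ E ∣ ≡ 2 * t) edges → size t (countAt Y edges) ≡ length edges
  size-countAt t edges sizes = begin
    ∑< N (countAt Y edges)                    ≡⟨ ∑<-cong N (λ k → length-filter≡count (meet Y) k edges) ⟩
    ∑< N (λ k → count k (map (meet Y) edges)) ≡⟨ ∑<-count≡length N (map (meet Y) edges) meets<N ⟩
    length (map (meet Y) edges)               ≡⟨ length-map (meet Y) edges ⟩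
    length edges                              ∎
    where
    open ≡-Reasoning
    N = suc (t + t)
    meets<N : All (_< N) (map (meet Y) edges)
    meets<N = map⁺ (All.map (λ {E} ∣E∣≡ → s≤s (≤-trans (∣p∩q∣≤∣p∣ E Y) (≤-reflexive (trans ∣E∣≡ (cong (t +_) (+-identityʳ t)))))) sizes)

  enough-edges : ∀ t (edges : List (Subset n)) → All (λ E → ∣ E ∣ ≡ 2 * t) edges →
                 ∀ p → p ≤ length edges / 3 → 3 * p ≤ size t (countAt Y edges)
  enough-edges t edges sizes p p≤ = begin
    3 * p                       ≡⟨ *-comm 3 p ⟩
    p * 3                       ≤⟨ *-monoˡ-≤ 3 p≤ ⟩
    length edges / 3 * 3        ≤⟨ m/n*n≤m (length edges) 3 ⟩
    length edges                ≡⟨ size-countAt t edges sizes ⟨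
    size t (countAt Y edges)    ∎
    where open ≤-Reasoning

  realize-plan : ∀ {t p} (edges : List (Subset n)) → Unique edges → Plan t p (countAt Y edges) →
                 Σ (List (Subset n × Subset n × Subset n)) λ T →
                   length T ≡ p × Unique (flatten T) × All (_∈ edges) (flatten T) ×
                   All (λ { (E₁ , E₂ , E₃) → meet Y E₁ + meet Y E₂ + meet Y E₃ ≡ 3 * t }) T ×
                   (∀ i → i ≤ t → countAt Y (flatten T) (t + i) ≡ countAt Y (flatten T) (t ∸ i))
  realize-plan {t} {p} edges edges-unique P = T , length-T , T-unique , T⊆edges , T-balanced , T-symmetric
    where
    module P = Plan P
    selected = select-triples P.triples edges edges-unique P.within
    T = proj₁ selected
    meets≡ = proj₁ (proj₂ selected)
    T-unique = proj₁ (proj₂ (proj₂ selected))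
    T⊆edges = proj₂ (proj₂ (proj₂ selected))
    length-T : length T ≡ p
    length-T = trans (sym (length-map meets T)) (trans (cong length meets≡) P.length-triples)
    T-balanced : All (λ { (E₁ , E₂ , E₃) → meet Y E₁ + meet Y E₂ + meet Y E₃ ≡ 3 * t }) T
    T-balanced = map⁻ (subst (All (Balanced t)) (sym meets≡) P.balanced)
    T-symmetric : ∀ i → i ≤ t → countAt Y (flatten T) (t + i) ≡ countAt Y (flatten T) (t ∸ i)
    T-symmetric i i≤t = begin
      countAt Y (flatten T) (t + i)  ≡⟨ countAt-flatten T (t + i) ⟩
      occ (map meets T) (t + i)      ≡⟨ cong (λ ts → occ ts (t + i)) meets≡ ⟩
      occ P.triples (t + i)          ≡⟨ P.symmetric i i≤t ⟩
      occ P.triples (t ∸ i)          ≡⟨ cong (λ ts → occ ts (t ∸ i)) meets≡ ⟨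
      occ (map meets T) (t ∸ i)      ≡⟨ countAt-flatten T (t ∸ i) ⟨
      countAt Y (flatten T) (t ∸ i)  ∎
      where open ≡-Reasoning

lemma8 : (t : ℕ) → 1 ≤ t →
    (n : ℕ) (edges : List (Subset n)) → Unique edges →
    edges ≢ [] →
    All (λ E → ∣ E ∣ ≡ 2 * t) edges →
    (Y : Subset n) →
    (e : ℕ → ℕ) →
    (∀ i → i ≤ t → countAt Y edges (t + i) ≡ e i × countAt Y edges (t ∸ i) ≡ e i) →
    (∀ s → s ≤ t → 0 < e s → (∀ j → s < j → j ≤ t → e j ≡ 0) →
       ∀ i → i < s → e (1 + i) + s ≤ e i) →
    (p : ℕ) → p ≤ length edges / 3 →
    Σ (List (Subset n × Subset n × Subset n)) λ triples →
      length triples ≡ p ×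
      Unique (flatten triples) ×
      All (λ E → E ∈ edges) (flatten triples) ×
      All (λ { (E₁ , E₂ , E₃) → meet Y E₁ + meet Y E₂ + meet Y E₃ ≡ 3 * t }) triples ×
      (∀ i → 1 ≤ i → i ≤ t →
         countAt Y (flatten triples) (t + i) ≡ countAt Y (flatten triples) (t ∸ i))
lemma8 t _ n edges edges-unique _ sizes Y e level-counts gapped p p≤ =
  let T , length-T , T-unique , T⊆edges , T-balanced , T-symmetric = realize-plan Y edges edges-unique level-plan
  in T , length-T , T-unique , T⊆edges , T-balanced , λ i _ → T-symmetric i
  where
  top = steep-level t e (λ i i≤t → proj₁ (level-counts i i≤t)) gapped
  level-plan = plan t (proj₁ top + p) (record
    { s≤t = proj₁ (proj₂ top)
    ; c-symmetric = record { mirror = λ i i≤t → trans (proj₁ (level-counts i i≤t)) (sym (proj₂ (level-counts i i≤t))) }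
    ; c-steep = proj₂ (proj₂ top)
    ; enough = enough-edges Y t edges sizes p p≤ }) ≤-refl
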